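{- Let $\mathrm{M}$ be a matroid and let $F, G \in \overline{\mathcal{L}}_{\mathrm{M}}$ be such that $G$ covers $F \wedge G$. Then $h_G h_F = h_G h_{G \vee F}$ in $A^{\bullet}(\mathrm{M})$.
   Context: A matroid $\mathrm{M}$ is a finite nonempty atomic ranked lattice $\mathcal{L}_{\mathrm{M}}$ (every element is the join of the atoms below it; every maximal chain in $[\emptyset, F]$ has length $\operatorname{rk}(F)$) whose rank function $\operatorname{rk}$ is submodular. Elements are called flats; the minimal element is $\emptyset$, the maximal $E$. Let $\overline{\mathcal{L}}_{\mathrm{M}} = \mathcal{L}_{\mathrm{M}} \setminus \{\emptyset\}$. $G$ covers $H$ means $H \le G$ and $\operatorname{rk}(G) = \operatorname{rk}(H)+1$. The augmented Chow ring is $$A^{\bullet}(\mathrm{M}) = \frac{\mathbb{Z}[h_F]_{F \in \overline{\mathcal{L}}_{\mathrm{M}}}}{((h_{F} - h_{G \vee F})(h_G - h_{G \vee F}) : F, G \in \overline{\mathcal{L}}_{\mathrm{M}}) + (h_a^2,\ h_ah_F - h_ah_{F \vee a} : F \in \overline{\mathcal{L}}_{\mathrm{M}},\ a \text{ an atom})}.$$ -}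

module Defs where

open import Data.Nat using (ℕ; zero; suc; _+_) renaming (_≤_ to _≤ℕ_)
open import Data.Fin using (Fin)
open import Data.Product using (_×_; _,_; proj₁; proj₂)
open import Data.Sum using (_⊎_)
open import Relation.Binary.PropositionalEquality using (_≡_; _≢_; refl; sym; subst)
open import Relation.Binary.Lattice.Structures using (IsBoundedLattice)
open import Relation.Binary.Structures using (IsPartialOrder)

-- Matroids as finite atomic ranked lattices with submodular rank
-- (flats are the elements of Fin n, so the lattice is finite;
--  it is nonempty since it has a bottom element).

record FiniteLattice : Set₁ where
  field
    n     : ℕ
  Flat : Set
  Flat = Fin n
  field
    _≤_   : Flat → Flat → Set
    _∨_   : Flat → Flat → Flat
    _∧_   : Flat → Flat → Flat
    top   : Flat
    bot   : Flat
    isBoundedLattice : IsBoundedLattice _≡_ _≤_ _∨_ _∧_ top bot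

module LatticeNotions (L : FiniteLattice) where
  open FiniteLattice L

  _<_ : Flat → Flat → Set
  x < y = (x ≤ y) × (x ≢ y)

  _⋖_ : Flat → Flat → Set
  x ⋖ y = (x < y) × (∀ z → x ≤ z → z ≤ y → (z ≡ x) ⊎ (z ≡ y))

  IsAtom : Flat → Set
  IsAtom a = bot ⋖ a

  -- maximal chains of [∅, F] (in a finite lattice: saturated chains
  -- ∅ = F₀ ⋖ F₁ ⋖ … ⋖ F_k = F), indexed by their endpoint and length k
  data MaxChain : Flat → ℕ → Set where
    start : MaxChain bot zero
    step  : ∀ {x y k} → MaxChain x k → x ⋖ y → MaxChain y (suc k)

record Matroid : Set₁ where
  field
    lattice : FiniteLattice
  open FiniteLattice lattice public
  open LatticeNotions lattice public
  field
    atomic : ∀ F x → (∀ a → IsAtom a → a ≤ F → a ≤ x) → F ≤ x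
    rk     : Flat → ℕ
    ranked : ∀ F k → MaxChain F k → rk F ≡ k
    submodular : ∀ F G → (rk (F ∧ G) + rk (F ∨ G)) ≤ℕ (rk F + rk G)

  open IsBoundedLattice isBoundedLattice public
    using (antisym; x≤x∨y; y≤x∨y; minimum)

  ∨-nonbot : ∀ F G → F ≢ bot → (F ∨ G) ≢ bot
  ∨-nonbot F G p e = p (antisym (subst (F ≤_) e (x≤x∨y F G)) (minimum F))

  atom-nonbot : ∀ a → IsAtom a → a ≢ bot
  atom-nonbot a ((_ , ne) , _) e = ne (sym e)

module ChowRing (M : Matroid) where
  open Matroid M public

  -- Polynomial ring ℤ[h_F : F ∈ L̄_M], presented as terms of the free
  -- commutative ring (ℤ is generated by 1) in the variables h_F, F ≠ ∅.
  -- The nonemptiness proof is irrelevant, so h F p ≡ h F q.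

  infixl 6 _⊕_ _⊖_
  infixl 7 _⊗_
  data Poly : Set where
    h    : (F : Flat) → .(F ≢ bot) → Poly
    𝟘 𝟙  : Poly
    _⊕_  : Poly → Poly → Poly
    _⊗_  : Poly → Poly → Poly
    ⊝_   : Poly → Poly

  _⊖_ : Poly → Poly → Poly
  p ⊖ q = p ⊕ (⊝ q)

  -- the generators of the ideal defining the augmented Chow ring
  data ChowRel : Poly → Set where
    rel-FG  : ∀ F G (pF : F ≢ bot) (pG : G ≢ bot) →
              ChowRel ((h F pF ⊖ h (G ∨ F) (∨-nonbot G F pG))
                     ⊗ (h G pG ⊖ h (G ∨ F) (∨-nonbot G F pG)))
    rel-aa  : ∀ a (at : IsAtom a) →
              ChowRel (h a (atom-nonbot a at) ⊗ h a (atom-nonbot a at))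
    rel-aF  : ∀ a (at : IsAtom a) F (pF : F ≢ bot) →
              ChowRel (h a (atom-nonbot a at) ⊗ h F pF
                     ⊖ h a (atom-nonbot a at) ⊗ h (F ∨ a) (∨-nonbot F a pF))

  -- equality in A^•(M): the smallest congruence for the commutative ring
  -- operations that satisfies the commutative ring axioms and identifies
  -- every generator of the ideal with 0.
  infix 4 _≈A_
  data _≈A_ : Poly → Poly → Set where
    ≈refl  : ∀ {p} → p ≈A p
    ≈sym   : ∀ {p q} → p ≈A q → q ≈A p
    ≈trans : ∀ {p q r} → p ≈A q → q ≈A r → p ≈A r
    ⊕-cong : ∀ {p p' q q'} → p ≈A p' → q ≈A q' → p ⊕ q ≈A p' ⊕ q'
    ⊗-cong : ∀ {p p' q q'} → p ≈A p' → q ≈A q' → p ⊗ q ≈A p' ⊗ q'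
    ⊝-cong : ∀ {p q} → p ≈A q → ⊝ p ≈A ⊝ q
    ⊕-assoc : ∀ p q r → (p ⊕ q) ⊕ r ≈A p ⊕ (q ⊕ r)
    ⊕-comm  : ∀ p q → p ⊕ q ≈A q ⊕ p
    ⊕-idˡ   : ∀ p → 𝟘 ⊕ p ≈A p
    ⊝-invˡ  : ∀ p → (⊝ p) ⊕ p ≈A 𝟘
    ⊗-assoc : ∀ p q r → (p ⊗ q) ⊗ r ≈A p ⊗ (q ⊗ r)
    ⊗-comm  : ∀ p q → p ⊗ q ≈A q ⊗ p
    ⊗-idˡ   : ∀ p → 𝟙 ⊗ p ≈A p
    distribˡ : ∀ p q r → p ⊗ (q ⊕ r) ≈A (p ⊗ q) ⊕ (p ⊗ r)
    ideal   : ∀ {p} → ChowRel p → p ≈A 𝟘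

{-# OPTIONS --safe #-}
module Submission where

-- Since rk G = rk (F ∧ G) + 1 and the rank is strictly monotone (a maximal chain
-- below X extends to a strictly longer one below any Y > X), G covers F ∧ G, so by
-- atomicity G = (F ∧ G) ∨ a for an atom a ≤ G, and then F ∨ a = G ∨ F =: K.  Writing
-- D = h_F − h_K, the relations for the pairs (F, G) and (a, F) and the atom relation for
-- (a, F) read D (h_G − h_K) = D (h_a − h_K) = h_a D = 0.  Hence D h_K = D h_a = 0, so
-- D h_G = 0, which is h_G h_F = h_G h_K.

open import Defs
open import Data.Nat using (suc)
open import Relation.Binary.PropositionalEquality using (_≡_; _≢_)

open import Algebra.Bundles using (CommutativeRing)
import Algebra.Consequences.Setoid
import Algebra.Properties.Ring as RingProperties
open import Data.Empty using (⊥-elim)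
open import Data.Fin.Induction using (po-wellFounded; po-noetherian)
open import Data.Fin.Properties using (_≟_; any?; all?)
open import Data.Nat using (zero) renaming (_<_ to _<ℕ_)
open import Data.Nat.Properties using (n<1+n; 1+n≢n; <⇒≤; <⇒≱; ≤-pred)
open import Data.Product using (_×_; _,_; proj₁; ∃-syntax)
open import Data.Sum using (_⊎_; inj₁; inj₂)
open import Function using (_∘_; flip)
open import Level using (0ℓ)
open import Induction.WellFounded using (WellFounded; Acc; acc)
open import Relation.Binary.Bundles using (Setoid)
open import Relation.Binary.Structures using (IsEquivalence)
open import Relation.Binary.Lattice.Bundles using (JoinSemilattice)
import Relation.Binary.Lattice.Properties.JoinSemilattice as JoinSemilatticeProperties
open import Relation.Binary.Lattice.Structures using (IsBoundedLattice)
open import Relation.Binary.PropositionalEquality using (refl; sym; subst; subst₂)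
open import Relation.Nullary using (Dec; yes; no; ¬_)
open import Relation.Nullary.Decidable using (map′; _×-dec_; _⊎-dec_; _→-dec_; ¬?; decidable-stable)

module MatroidProperties (M : Matroid) where
  open Matroid M
  open IsBoundedLattice isBoundedLattice
    using (isPartialOrder; isJoinSemilattice; ∨-least; x∧y≤x; x∧y≤y)
    renaming (refl to ≤-refl; trans to ≤-trans)

  joinSemilattice : JoinSemilattice _ _ _
  joinSemilattice = record { isJoinSemilattice = isJoinSemilattice }

  open JoinSemilatticeProperties joinSemilattice using (∨-monotonic; x≤y⇒x∨y≈y)

  _≤?_ : ∀ x y → Dec (x ≤ y)
  x ≤? y = map′ (λ x∨y≡y → subst (x ≤_) x∨y≡y (x≤x∨y x y)) x≤y⇒x∨y≈y (x ∨ y ≟ y)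

  _<?_ : ∀ x y → Dec (x < y)
  x <? y = (x ≤? y) ×-dec ¬? (x ≟ y)

  _⋖?_ : ∀ x y → Dec (x ⋖ y)
  x ⋖? y = (x <? y) ×-dec all? (λ z → (x ≤? z) →-dec (z ≤? y) →-dec ((z ≟ x) ⊎-dec (z ≟ y)))

  ⋖-or-between : ∀ {X Y} → X < Y → X ⋖ Y ⊎ ∃[ z ] X < z × z < Y
  ⋖-or-between {X} {Y} X<Y with any? (λ z → (X <? z) ×-dec (z <? Y))
  ... | yes between = inj₂ between
  ... | no nothingBetween = inj₁ (X<Y , endpoints)
    where
    endpoints : ∀ z → X ≤ z → z ≤ Y → z ≡ X ⊎ z ≡ Y
    endpoints z X≤z z≤Y with z ≟ X | z ≟ Y
    ... | yes z≡X | _ = inj₁ z≡X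
    ... | no _ | yes z≡Y = inj₂ z≡Y
    ... | no z≢X | no z≢Y =
      ⊥-elim (nothingBetween (z , (X≤z , z≢X ∘ sym) , (z≤Y , z≢Y)))

  <-wellFounded : WellFounded _<_
  <-wellFounded = po-wellFounded isPartialOrder

  <-noetherian : WellFounded (flip _<_)
  <-noetherian = po-noetherian isPartialOrder

  ⋖-below : ∀ {X Y} → X < Y → ∃[ W ] X ⋖ W × W ≤ Y
  ⋖-below {X} {Y} = go (<-wellFounded Y)
    where
    go : ∀ {Y} → Acc _<_ Y → X < Y → ∃[ W ] X ⋖ W × W ≤ Y
    go (acc below) X<Y with ⋖-or-between X<Y
    ... | inj₁ X⋖Y = _ , X⋖Y , ≤-refl
    ... | inj₂ (Z , X<Z , Z<Y) with go (below Z<Y) X<Z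
    ...   | W , X⋖W , W≤Z = W , X⋖W , ≤-trans W≤Z (proj₁ Z<Y)

  extendMaxChain : ∀ {X Y k} → MaxChain X k → X < Y → ∃[ j ] MaxChain Y j × k <ℕ j
  extendMaxChain {X} {Y} = go (<-noetherian X)
    where
    go : ∀ {X k} → Acc (flip _<_) X → MaxChain X k → X < Y → ∃[ j ] MaxChain Y j × k <ℕ j
    go {k = k} (acc above) c X<Y with ⋖-below X<Y
    ... | W , X⋖W , W≤Y with W ≟ Y
    ...   | yes refl = suc k , step c X⋖W , n<1+n k
    ...   | no W≢Y with go (above (proj₁ X⋖W)) (step c X⋖W) (W≤Y , W≢Y)
    ...     | j , c′ , 1+k<j = j , c′ , <⇒≤ 1+k<j

  maxChain : ∀ X → ∃[ k ] MaxChain X k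
  maxChain X with X ≟ bot
  ... | yes refl = zero , start
  ... | no X≢bot = let j , c , _ = extendMaxChain start (minimum X , X≢bot ∘ sym) in j , c

  rk-mono-< : ∀ {X Y} → X < Y → rk X <ℕ rk Y
  rk-mono-< {X} {Y} X<Y =
    let k , c = maxChain X
        j , c′ , k<j = extendMaxChain c X<Y
    in subst₂ _<ℕ_ (sym (ranked X k c)) (sym (ranked Y j c′)) k<j

  rk-suc⇒⋖ : ∀ {X Y} → X ≤ Y → rk Y ≡ suc (rk X) → X ⋖ Y
  rk-suc⇒⋖ {X} {Y} X≤Y rkY with ⋖-or-between (X≤Y , λ { refl → 1+n≢n (sym rkY) })
  ... | inj₁ X⋖Y = X⋖Y
  ... | inj₂ (Z , X<Z , Z<Y) =
    ⊥-elim (<⇒≱ (rk-mono-< X<Z) (≤-pred (subst (rk Z <ℕ_) rkY (rk-mono-< Z<Y))))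

  ≰⇒∃-atom : ∀ {X Y} → ¬ Y ≤ X → ∃[ a ] IsAtom a × a ≤ Y × ¬ a ≤ X
  ≰⇒∃-atom {X} {Y} Y≰X with any? (λ a → (bot ⋖? a) ×-dec (a ≤? Y) ×-dec ¬? (a ≤? X))
  ... | yes found = found
  ... | no none = ⊥-elim (Y≰X (atomic Y X λ a atom a≤Y →
          decidable-stable (a ≤? X) (λ a≰X → none (a , atom , a≤Y , a≰X))))

  ⋖⇒∨-atom : ∀ {X Y} → X ⋖ Y → ∃[ a ] IsAtom a × a ≤ Y × (X ∨ a) ≡ Y
  ⋖⇒∨-atom {X} {Y} ((X≤Y , X≢Y) , onlyEndpoints) with ≰⇒∃-atom (X≢Y ∘ antisym X≤Y)
  ... | a , atom , a≤Y , a≰X with onlyEndpoints (X ∨ a) (x≤x∨y X a) (∨-least X≤Y a≤Y)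
  ...   | inj₁ X∨a≡X = ⊥-elim (a≰X (subst (a ≤_) X∨a≡X (y≤x∨y X a)))
  ...   | inj₂ X∨a≡Y = a , atom , a≤Y , X∨a≡Y

  rk-cover⇒∨-atom : ∀ F G → rk G ≡ suc (rk (F ∧ G)) → ∃[ a ] IsAtom a × (F ∨ a) ≡ (G ∨ F)
  rk-cover⇒∨-atom F G rkG with ⋖⇒∨-atom (rk-suc⇒⋖ (x∧y≤y F G) rkG)
  ... | a , atom , a≤G , F∧G∨a≡G = a , atom , antisym F∨a≤G∨F G∨F≤F∨a
    where
    F∨a≤G∨F : (F ∨ a) ≤ (G ∨ F)
    F∨a≤G∨F = ∨-least (y≤x∨y G F) (≤-trans a≤G (x≤x∨y G F))
    G≤F∨a : G ≤ (F ∨ a)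
    G≤F∨a = subst (_≤ (F ∨ a)) F∧G∨a≡G (∨-monotonic (x∧y≤x F G) ≤-refl)
    G∨F≤F∨a : (G ∨ F) ≤ (F ∨ a)
    G∨F≤F∨a = ∨-least G≤F∨a (x≤x∨y F a)

module CommutativeRingLemmas {c ℓ} (R : CommutativeRing c ℓ) where
  open CommutativeRing R renaming (trans to ≈-trans; sym to ≈-sym)
  open RingProperties ring using (x[y-z]≈xy-xz; x∙y⁻¹≈ε⇒x≈y)
  open import Relation.Binary.Reasoning.Setoid setoid

  x[y-z]≈0⇒xy≈xz : ∀ x y z → x * (y - z) ≈ 0# → x * y ≈ x * z
  x[y-z]≈0⇒xy≈xz x y z x[y-z]≈0 = x∙y⁻¹≈ε⇒x≈y _ _ (≈-trans (≈-sym (x[y-z]≈xy-xz x y z)) x[y-z]≈0)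

  yx≈yz-by-annihilators : ∀ x y z w →
    (x - z) * (y - z) ≈ 0# → (w - z) * (x - z) ≈ 0# → w * (x - z) ≈ 0# → y * x ≈ y * z
  yx≈yz-by-annihilators x y z w [x-z][y-z]≈0 [w-z][x-z]≈0 w[x-z]≈0 =
    x[y-z]≈0⇒xy≈xz y x z (begin
      y * d   ≈⟨ *-comm y d ⟩
      d * y   ≈⟨ x[y-z]≈0⇒xy≈xz d y z [x-z][y-z]≈0 ⟩
      d * z   ≈⟨ x[y-z]≈0⇒xy≈xz d w z (≈-trans (*-comm d (w - z)) [w-z][x-z]≈0) ⟨
      d * w   ≈⟨ *-comm d w ⟩
      w * d   ≈⟨ w[x-z]≈0 ⟩
      0#      ∎)
    where
    d = x - z

module ChowRingProperties (M : Matroid) where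
  open ChowRing M

  ≈A-isEquivalence : IsEquivalence _≈A_
  ≈A-isEquivalence = record { refl = ≈refl ; sym = ≈sym ; trans = ≈trans }

  ≈A-setoid : Setoid 0ℓ 0ℓ
  ≈A-setoid = record { isEquivalence = ≈A-isEquivalence }

  open Algebra.Consequences.Setoid ≈A-setoid
    using (comm∧idˡ⇒id; comm∧invˡ⇒inv; comm∧distrˡ⇒distr)

  chowRing : CommutativeRing 0ℓ 0ℓ
  chowRing = record
    { Carrier = Poly ; _≈_ = _≈A_ ; _+_ = _⊕_ ; _*_ = _⊗_ ; -_ = ⊝_ ; 0# = 𝟘 ; 1# = 𝟙
    ; isCommutativeRing = record
      { isRing = record
        { +-isAbelianGroup = record
          { isGroup = record
            { isMonoid = record
              { isSemigroup = record
                { isMagma = record { isEquivalence = ≈A-isEquivalence ; ∙-cong = ⊕-cong }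
                ; assoc = ⊕-assoc }
              ; identity = comm∧idˡ⇒id ⊕-comm ⊕-idˡ }
            ; inverse = comm∧invˡ⇒inv ⊕-comm ⊝-invˡ
            ; ⁻¹-cong = ⊝-cong }
          ; comm = ⊕-comm }
        ; *-cong = ⊗-cong
        ; *-assoc = ⊗-assoc
        ; *-identity = comm∧idˡ⇒id ⊗-comm ⊗-idˡ
        ; distrib = comm∧distrˡ⇒distr ⊕-cong ⊗-comm distribˡ }
      ; *-comm = ⊗-comm } }

  open RingProperties (CommutativeRing.ring chowRing) using (x[y-z]≈xy-xz)

  -- The join is abstracted as K so that the generators apply at flats equal to it only
  -- propositionally.
  rel-FG≈𝟘 : ∀ {F G K} (pF : F ≢ bot) (pG : G ≢ bot) (pK : K ≢ bot) → G ∨ F ≡ K →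
             (h F pF ⊖ h K pK) ⊗ (h G pG ⊖ h K pK) ≈A 𝟘
  rel-FG≈𝟘 pF pG _ refl = ideal (rel-FG _ _ pF pG)

  rel-aF≈𝟘 : ∀ {a F K} (atom : IsAtom a) (pF : F ≢ bot) (pK : K ≢ bot) → F ∨ a ≡ K →
             h a (atom-nonbot a atom) ⊗ (h F pF ⊖ h K pK) ≈A 𝟘
  rel-aF≈𝟘 atom pF _ refl = ≈trans (x[y-z]≈xy-xz _ _ _) (ideal (rel-aF _ atom _ pF))

lemma2p6 : (M : Matroid) → let open ChowRing M in
    ∀ F G (pF : F ≢ bot) (pG : G ≢ bot) →
    ((F ∧ G) ≤ G) → rk G ≡ suc (rk (F ∧ G)) →
    h G pG ⊗ h F pF ≈A h G pG ⊗ h (G ∨ F) (∨-nonbot G F pG)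
lemma2p6 M F G pF pG _ rkG =
  let a , atom , F∨a≡G∨F = rk-cover⇒∨-atom F G rkG
      pa = atom-nonbot a atom
      pK = ∨-nonbot G F pG
  in yx≈yz-by-annihilators (h F pF) (h G pG) (h (G ∨ F) pK) (h a pa)
       (rel-FG≈𝟘 pF pG pK refl)
       (rel-FG≈𝟘 pa pF pK F∨a≡G∨F)
       (rel-aF≈𝟘 atom pF pK F∨a≡G∨F)
  where
  open ChowRing M
  open MatroidProperties M
  open ChowRingProperties M
  open CommutativeRingLemmas chowRing using (yx≈yz-by-annihilators)
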